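{- Let $\mathcal G$ be a hypergraph, $\alpha\in V(\mathcal G)$, and let $\mathcal G'$ be an $(\alpha,2)$-detachment of $\mathcal G$ with $V(\mathcal G')=V(\mathcal G)\cup\{\beta\}$. Let $X_1,\dots,X_r$ be the list of all $\alpha$-wings of $\mathcal G$ that are detached in $\mathcal G'$, and let $W_1,\dots,W_s$ be the list of all $\alpha$-wings of $\mathcal G$ that are semi-detached in $\mathcal G'$, and assume this latter list is nonempty ($s\ge1$). Then $$Z:=\Big(\bigcup_{i\in[r]}X_i'\Big)\cup\Big(\bigcup_{i\in[s]}W_i'\Big)$$ is an $\alpha$-wing of $\mathcal G'$.
   Context: Hypergraphs have a finite vertex set and a finite multiset of edges, each edge a nonempty multiset of vertices; $\deg(v)$ counts all occurrences of $v$ in edges. An edge is incident with $v$ if $v$ occurs in it; a hypergraph is non-trivial if it has an edge; sub-hypergraph unions/intersections are on vertex sets and edge multisets. $(\alpha,2)$-detachment: $\mathcal G'$ is obtained by adding a new vertex $\beta$ and replacing each edge $\{\alpha^p\}\cup U$ ($U$ not containing $\alpha$) by an edge $\{\alpha^{p-i},\beta^i\}\cup U$ for some $0\le i\le p$; other edges unchanged. For a sub-hypergraph $W$ of $\mathcal G$, $W'$ is the sub-hypergraph of $\mathcal G'$ formed by the edges corresponding to the edges of $W$ (with the vertices of $W$, plus $\beta$ if $\beta$ occurs in these edges). A vertex $\alpha$ of a connected hypergraph $\mathcal G$ is a cut vertex if there are non-trivial sub-hypergraphs $I,J$ with $I\cup J=\mathcal G$, $V(I\cap J)=\{\alpha\}$,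 $E(I\cap J)=\varnothing$. A sub-hypergraph $W$ with $\alpha\in V(W)$ is an $\alpha$-wing of $\mathcal G$ if $W$ is non-trivial and connected, $\alpha$ is not a cut vertex of $W$, and no edge of $E(\mathcal G)\setminus E(W)$ is incident with a vertex of $V(W)\setminus\{\alpha\}$. An $\alpha$-wing $W$ of $\mathcal G$ is detached in $\mathcal G'$ if $\deg_{W'}(\alpha)=0$, and semi-detached if $1\le \deg_{W'}(\alpha)<\deg_W(\alpha)$. -}

module Defs where

open import Data.Nat using (ℕ; zero; suc; _<_; _≤_; _∸_; _<ᵇ_)
open import Data.Fin using (Fin; zero; suc; _≟_)
open import Data.Fin.Subset using (Subset; _∈_; _∉_; _⊆_; _∪_; _∩_; ⁅_⁆) renaming (⊥ to ∅)
open import Data.Vec using (Vec; _∷_; lookup; tabulate; sum)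
open import Data.Bool using (Bool; true; false; if_then_else_)
open import Data.Product using (Σ; ∃; _×_; _,_)
open import Data.Sum using (_⊎_)
open import Relation.Nullary using (¬_; does)
open import Relation.Binary.PropositionalEquality using (_≡_; _≢_)

-- A hypergraph on vertex set Fin n with edges indexed by Fin m:
-- edge j is the multiset of vertices given by the multiplicity function e j.
Edges : ℕ → ℕ → Set
Edges n m = Fin m → Fin n → ℕ

NonemptyEdges : ∀ {n m} → Edges n m → Set
NonemptyEdges {n} {m} e = ∀ (j : Fin m) → ∃ λ (v : Fin n) → 0 < e j v

record Sub (n m : ℕ) : Set where
  constructor sub
  field
    V : Subset n
    E : Subset m
open Sub public

IsSub : ∀ {n m} → Edges n m → Sub n m → Set
IsSub {n} {m} e H = ∀ (j : Fin m) → j ∈ E H → ∀ (v : Fin n) → 0 < e j v → v ∈ V H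

SubOf : ∀ {n m} → Edges n m → Sub n m → Sub n m → Set
SubOf e I H = IsSub e I × V I ⊆ V H × E I ⊆ E H

NonTrivial : ∀ {n m} → Sub n m → Set
NonTrivial {n} {m} H = ∃ λ (j : Fin m) → j ∈ E H

deg : ∀ {n m} → Edges n m → Subset m → Fin n → ℕ
deg e E v = sum (tabulate λ j → if lookup E j then e j v else 0)

data Reach {n m} (e : Edges n m) (H : Sub n m) (u : Fin n) : Fin n → Set where
  here : u ∈ V H → Reach e H u u
  step : ∀ {w v} (j : Fin m) → Reach e H u w → j ∈ E H → 0 < e j w → 0 < e j v → Reach e H u v

Connected : ∀ {n m} → Edges n m → Sub n m → Set
Connected {n} e H = ∀ (u v : Fin n) → u ∈ V H → v ∈ V H → Reach e H u v

IsCutVertex : ∀ {n m} → Edges n m → Sub n m → Fin n → Set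
IsCutVertex {n} {m} e H α =
  Σ (Sub n m) λ I → Σ (Sub n m) λ J →
    SubOf e I H × SubOf e J H × NonTrivial I × NonTrivial J ×
    (V I ∪ V J ≡ V H) × (E I ∪ E J ≡ E H) ×
    (V I ∩ V J ≡ ⁅ α ⁆) × (E I ∩ E J ≡ ∅)

IsWing : ∀ {n m} → Edges n m → Fin n → Sub n m → Set
IsWing {n} {m} e α W =
  IsSub e W × α ∈ V W × NonTrivial W × Connected e W × ¬ IsCutVertex e W α ×
  (∀ (j : Fin m) → j ∉ E W → ∀ (v : Fin n) → v ∈ V W → v ≢ α → e j v ≡ 0)

-- (α,2)-detachment: new vertex β is `zero`, old vertex v becomes `suc v`;
-- edge j moves i j of the copies of α to β (requires i j ≤ e j α).
detach : ∀ {n m} → Edges n m → Fin n → (Fin m → ℕ) → Edges (suc n) m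
detach e α i j zero = i j
detach e α i j (suc v) = if does (v ≟ α) then e j α ∸ i j else e j v

-- W' : same edges; vertices of W, plus β iff β occurs in an edge of W'
prime : ∀ {n m} → Edges n m → Fin n → (Fin m → ℕ) → Sub n m → Sub (suc n) m
prime e α i W = sub ((0 <ᵇ deg (detach e α i) (E W) zero) ∷ V W) (E W)

Detached : ∀ {n m} → Edges n m → Fin n → (Fin m → ℕ) → Sub n m → Set
Detached e α i W = deg (detach e α i) (E W) (suc α) ≡ 0

SemiDetached : ∀ {n m} → Edges n m → Fin n → (Fin m → ℕ) → Sub n m → Set
SemiDetached e α i W =
  1 ≤ deg (detach e α i) (E W) (suc α) × deg (detach e α i) (E W) (suc α) < deg e (E W) α

-- Two edges of an α-wing are always joined by a chain of edges in which consecutive edges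
-- share a vertex other than α: otherwise the edges reachable from one of them, and the rest,
-- span two sub-hypergraphs meeting only in α, so α would be a cut vertex of the wing.
-- Conversely, the edges chained in this way to an edge through α are the edges of an α-wing.
-- In 𝒢′ every detached or semi-detached wing keeps an edge through β, and its chains avoiding
-- α survive the detachment. Hence every edge of Z is chained, avoiding α, to one fixed edge
-- through β, which makes Z connected and α not a cut vertex of Z. Finally an edge outside Z
-- cannot meet β: it would lie in an α-wing W with deg_W′(α) < deg_W(α), i.e. in a detached or
-- semi-detached wing, whose edges all belong to Z.
module Submission where

open import Defs
open import Data.Nat using (ℕ; zero; suc; _≤_; _<_; _+_; _∸_)
open import Data.Nat.Properties
  using (_<?_; n≢0⇒n>0; >⇒≢; ≤-trans; <-≤-trans; m≤m+n; m≤n+m; m<m+n; +-identityʳ; +-cancelˡ-<;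
         m∸n+n≡m; <⇒<ᵇ; +-commutativeSemigroup)
  renaming (_≟_ to _≟ℕ_)
open import Data.Nat.Induction using (<-wellFounded)
open import Algebra.Properties.CommutativeSemigroup +-commutativeSemigroup using (interchange)
open import Induction.WellFounded using (Acc; acc)
open import Data.Fin using (Fin; zero; suc; _≟_)
open import Data.Fin.Properties using (any?) renaming (suc-injective to Fin-suc-injective)
open import Data.Fin.Subset using (Subset; _∈_; _∉_; _⊆_; _∪_; _∩_; ∁; ⁅_⁆; _-_; ∣_∣) renaming (⊥ to ∅)
open import Data.Fin.Subset.Properties
  using (_∈?_; ⊆-antisym; x∈p∪q⁺; x∈p∪q⁻; x∈p∩q⁺; x∈p∩q⁻; p∩q⊆p; x∈⁅x⁆; x∈⁅y⁆⇒x≡y; ∉⊥;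
         x∈∁p⇒x∉p; x∉p⇒x∈∁p; x∉∁p⇒x∈p; p─q⊆p; x∈p∧x≢y⇒x∈p-y; x∈p⇒∣p-x∣<∣p∣; drop-there)
open import Data.Vec using (_∷_; here; there; lookup; tabulate; sum)
open import Data.Vec.Properties using (lookup∘tabulate; []=⇒lookup; lookup⇒[]=; tabulate-cong)
open import Data.Bool using (true; false; T; if_then_else_)
open import Data.Product using (∃; _×_; _,_; proj₁; proj₂)
open import Data.Sum using (_⊎_; inj₁; inj₂; [_,_]′) renaming (swap to ⊎-swap)
open import Data.Empty using (⊥-elim)
open import Function using (_∘_)
open import Function.Bundles using (_⇔_; Equivalence)
open import Relation.Nullary using (¬_; Dec; yes; no; does)
open import Relation.Nullary.Decidable using (_×-dec_; _⊎-dec_; ¬?; dec-true)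
open import Relation.Binary.PropositionalEquality using (_≡_; _≢_; refl; sym; trans; cong; subst; subst₂)
open import Relation.Binary.Construct.Closure.ReflexiveTransitive using (Star; ε; _◅_; _◅◅_; map)

subsetOf : ∀ {N} {P : Fin N → Set} → (∀ x → Dec (P x)) → Subset N
subsetOf P? = tabulate (does ∘ P?)

∈-subsetOf⁺ : ∀ {N} {P : Fin N → Set} (P? : ∀ x → Dec (P x)) {x} → P x → x ∈ subsetOf P?
∈-subsetOf⁺ P? {x} px = lookup⇒[]= x _ (trans (lookup∘tabulate _ x) (dec-true (P? x) px))

∈-subsetOf⁻ : ∀ {N} {P : Fin N → Set} (P? : ∀ x → Dec (P x)) {x} → x ∈ subsetOf P? → P x
∈-subsetOf⁻ P? {x} x∈ with P? x | trans (sym (lookup∘tabulate (does ∘ P?) x)) ([]=⇒lookup x∈)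
... | yes px | _ = px
... | no _ | ()

star-preserves : ∀ {I : Set} {L : I → I → Set} (P : I → Set) → (∀ {c d} → P c → L c d → P d)
  → ∀ {k c} → P k → Star L k c → P c
star-preserves P preserve pk ε = pk
star-preserves P preserve pk (l ◅ ls) = star-preserves P preserve (preserve pk l) ls

Within : ∀ {N} → Subset N → (Fin N → Fin N → Set) → Fin N → Fin N → Set
Within S L c d = d ∈ S × L c d

star-within : ∀ {N} {L : Fin N → Fin N → Set} (S : Subset N) → (∀ {c d} → c ∈ S → L c d → d ∈ S)
  → ∀ {k c} → k ∈ S → Star L k c → Star (Within S L) k c
star-within S closed k∈S ε = ε
star-within S closed k∈S (l ◅ ls) = (closed k∈S l , l) ◅ star-within S closed (closed k∈S l) ls

record Closure {N} (L : Fin N → Fin N → Set) (k : Fin N) : Set where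
  field
    members   : Subset N
    source∈   : k ∈ members
    reachable : ∀ {c} → c ∈ members → Star L k c
    closed    : ∀ {c d} → c ∈ members → L c d → d ∈ members

module _ {N} {L : Fin N → Fin N → Set} (L? : ∀ c d → Dec (L c d)) (k : Fin N) where

  -- R is the set of points not yet known to be reachable; it loses one point per round.
  private
    explore : (R : Subset N) → Acc _<_ ∣ R ∣ → k ∉ R → (∀ {c} → c ∉ R → Star L k c) → Closure L k
    explore R (acc smaller) k∉R path with any? (λ c → any? λ d → ¬? (c ∈? R) ×-dec (d ∈? R) ×-dec L? c d)
    ... | yes (c , d , c∉R , d∈R , cd) =
      explore (R - d) (smaller (x∈p⇒∣p-x∣<∣p∣ d∈R)) (k∉R ∘ p─q⊆p R ⁅ d ⁆) path′
      where
      path′ : ∀ {c′} → c′ ∉ R - d → Star L k c′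
      path′ {c′} c′∉ with c′ ≟ d
      ... | yes refl = path c∉R ◅◅ cd ◅ ε
      ... | no c′≢d = path (λ c′∈R → c′∉ (x∈p∧x≢y⇒x∈p-y c′∈R c′≢d))
    ... | no stuck = record
      { members = ∁ R ; source∈ = x∉p⇒x∈∁p k∉R ; reachable = path ∘ x∈∁p⇒x∉p ; closed = closed }
      where
      closed : ∀ {c d} → c ∈ ∁ R → L c d → d ∈ ∁ R
      closed {c} {d} c∈ cd with d ∈? R
      ... | yes d∈R = ⊥-elim (stuck (c , d , x∈∁p⇒x∉p c∈ , d∈R , cd))
      ... | no d∉R = x∉p⇒x∈∁p d∉R

    start : ∀ {c} → c ∉ ∁ ⁅ k ⁆ → Star L k c
    start c∉ with x∈⁅y⁆⇒x≡y k (x∉∁p⇒x∈p c∉)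
    ... | refl = ε

  closure : Closure L k
  closure = explore (∁ ⁅ k ⁆) (<-wellFounded _) (λ k∈ → x∈∁p⇒x∉p k∈ (x∈⁅x⁆ k)) start

≤-sum-tabulate : ∀ {m} (h : Fin m → ℕ) j → h j ≤ sum (tabulate h)
≤-sum-tabulate h zero = m≤m+n _ _
≤-sum-tabulate h (suc j) = ≤-trans (≤-sum-tabulate (h ∘ suc) j) (m≤n+m _ (h zero))

sum-tabulate-pos : ∀ {m} (h : Fin m → ℕ) → 0 < sum (tabulate h) → ∃ λ j → 0 < h j
sum-tabulate-pos {zero} h ()
sum-tabulate-pos {suc m} h pos with h zero ≟ℕ 0
... | no h₀≢0 = zero , n≢0⇒n>0 h₀≢0
... | yes h₀≡0 with sum-tabulate-pos (h ∘ suc) (subst (λ x → 0 < x + sum (tabulate (h ∘ suc))) h₀≡0 pos)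
...   | j , hj = suc j , hj

sum-tabulate-+ : ∀ {m} (g h : Fin m → ℕ)
  → sum (tabulate λ j → g j + h j) ≡ sum (tabulate g) + sum (tabulate h)
sum-tabulate-+ {zero} g h = refl
sum-tabulate-+ {suc m} g h =
  trans (cong (g zero + h zero +_) (sum-tabulate-+ (g ∘ suc) (h ∘ suc)))
        (interchange (g zero) (h zero) (sum (tabulate (g ∘ suc))) (sum (tabulate (h ∘ suc))))

module _ {n m} (f : Edges n m) where

  IncidentIn : Subset m → Fin n → Set
  IncidentIn F v = ∃ λ j → j ∈ F × 0 < f j v

  incidentIn? : ∀ F v → Dec (IncidentIn F v)
  incidentIn? F v = any? λ j → (j ∈? F) ×-dec (0 <? f j v)

  deg-≥ : ∀ {F j} v → j ∈ F → f j v ≤ deg f F v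
  deg-≥ {F} {j} v j∈F =
    subst (_≤ deg f F v) (cong (λ b → if b then f j v else 0) ([]=⇒lookup j∈F))
      (≤-sum-tabulate (λ k → if lookup F k then f k v else 0) j)

  deg-pos⇒incident : ∀ {F} v → 0 < deg f F v → IncidentIn F v
  deg-pos⇒incident {F} v pos with sum-tabulate-pos (λ k → if lookup F k then f k v else 0) pos
  ... | j , j-pos with lookup F j in j∈?F
  ...   | true = j , lookup⇒[]= j F j∈?F , j-pos

  Touch : Fin n → Fin m → Fin m → Set
  Touch a c d = ∃ λ v → v ≢ a × 0 < f c v × 0 < f d v

  touch? : ∀ a c d → Dec (Touch a c d)
  touch? a c d = any? λ v → ¬? (v ≟ a) ×-dec (0 <? f c v) ×-dec (0 <? f d v)

  Chain : Fin n → Subset m → Fin m → Fin m → Set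
  Chain a S = Star (Within S (Touch a))

  ChainedFrom : Fin n → Sub n m → Fin m → Set
  ChainedFrom a H r = ∀ {k} → k ∈ E H → Chain a (E H) r k

  reach-trans : ∀ {H u w v} → Reach f H u w → Reach f H w v → Reach f H u v
  reach-trans r (here _) = r
  reach-trans r (step j r′ j∈H w∈j v∈j) = step j (reach-trans r r′) j∈H w∈j v∈j

  reach-sym : ∀ {H u v} → IsSub f H → Reach f H u v → Reach f H v u
  reach-sym H-sub (here u∈H) = here u∈H
  reach-sym H-sub (step {w} {v} j r j∈H w∈j v∈j) =
    reach-trans (step j (here (H-sub j j∈H v v∈j)) j∈H v∈j w∈j) (reach-sym H-sub r)

  reach⇒≡⊎incident : ∀ {H u v} → Reach f H u v → u ≡ v ⊎ IncidentIn (E H) v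
  reach⇒≡⊎incident (here _) = inj₁ refl
  reach⇒≡⊎incident (step j _ j∈H _ v∈j) = inj₂ (j , j∈H , v∈j)

  chain-reach : ∀ {H a r k x w y} → r ∈ E H → Reach f H x w → 0 < f r w
    → Chain a (E H) r k → 0 < f k y → Reach f H x y
  chain-reach r∈H xw w∈r ε y∈k = step _ xw r∈H w∈r y∈k
  chain-reach r∈H xw w∈r ((d∈H , v , _ , v∈r , v∈d) ◅ ch) y∈k =
    chain-reach d∈H (step _ xw r∈H w∈r v∈r) v∈d ch y∈k

  chain-side : ∀ {a S} (I J : Sub n m) → IsSub f I → IsSub f J
    → (∀ {v} → v ∈ V I → v ∈ V J → v ≡ a) → (∀ {j} → j ∈ S → j ∈ E I ⊎ j ∈ E J)
    → ∀ {r k} → r ∈ E I → Chain a S r k → k ∈ E I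
  chain-side {a} I J I-sub J-sub meet covers = star-preserves (_∈ E I) stay
    where
    stay : ∀ {c d} → c ∈ E I → Within _ (Touch a) c d → d ∈ E I
    stay {c} {d} c∈I (d∈S , v , v≢a , v∈c , v∈d) with covers d∈S
    ... | inj₁ d∈I = d∈I
    ... | inj₂ d∈J = ⊥-elim (v≢a (meet (I-sub c c∈I v v∈c) (J-sub d d∈J v v∈d)))

  rooted⇒¬cut : ∀ {a H r} → r ∈ E H → ChainedFrom a H r → ¬ IsCutVertex f H a
  rooted⇒¬cut {a} {H} r∈H chained
    (I , J , (I-sub , _ , I⊆H) , (J-sub , _ , J⊆H) , (k , k∈I) , (l , l∈J) , _ , E∪ , V∩ , E∩) =
    [ (λ r∈I → disjoint (chain-side I J I-sub J-sub meet covers r∈I (chained (J⊆H l∈J))) l∈J)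
    , (λ r∈J → disjoint k∈I
        (chain-side J I J-sub I-sub (λ v∈J v∈I → meet v∈I v∈J) (⊎-swap ∘ covers) r∈J (chained (I⊆H k∈I))))
    ]′ (covers r∈H)
    where
    covers : ∀ {j} → j ∈ E H → j ∈ E I ⊎ j ∈ E J
    covers {j} j∈H = x∈p∪q⁻ (E I) (E J) (subst (j ∈_) (sym E∪) j∈H)
    meet : ∀ {v} → v ∈ V I → v ∈ V J → v ≡ a
    meet {v} v∈I v∈J = x∈⁅y⁆⇒x≡y a (subst (v ∈_) V∩ (x∈p∩q⁺ (v∈I , v∈J)))
    disjoint : ∀ {j} → j ∈ E I → j ∉ E J
    disjoint {j} j∈I j∈J = ∉⊥ (subst (j ∈_) E∩ (x∈p∩q⁺ (j∈I , j∈J)))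

  rooted⇒connected : ∀ {a H r ρ} → IsSub f H → r ∈ E H → 0 < f r ρ → ChainedFrom a H r
    → (∀ {v} → v ∈ V H → IncidentIn (E H) v) → Connected f H
  rooted⇒connected {H = H} {r} {ρ} H-sub r∈H ρ∈r chained incident u v u∈H v∈H =
    reach-trans (reach-sym H-sub (from-ρ u∈H)) (from-ρ v∈H)
    where
    from-ρ : ∀ {x} → x ∈ V H → Reach f H ρ x
    from-ρ x∈H with incident x∈H
    ... | k , k∈H , x∈k = chain-reach r∈H (here (H-sub r r∈H ρ ρ∈r)) ρ∈r (chained k∈H) x∈k

  span : Fin n → Subset m → Sub n m
  span a F = sub (subsetOf λ v → (v ≟ a) ⊎-dec incidentIn? F v) F

  ∈span⁺ : ∀ {a F v} → v ≡ a ⊎ IncidentIn F v → v ∈ V (span a F)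
  ∈span⁺ {a} {F} = ∈-subsetOf⁺ λ v → (v ≟ a) ⊎-dec incidentIn? F v

  ∈span⁻ : ∀ {a F v} → v ∈ V (span a F) → v ≡ a ⊎ IncidentIn F v
  ∈span⁻ {a} {F} = ∈-subsetOf⁻ λ v → (v ≟ a) ⊎-dec incidentIn? F v

  span-isSub : ∀ {a F} → IsSub f (span a F)
  span-isSub j j∈F v v∈j = ∈span⁺ (inj₂ (j , j∈F , v∈j))

  span-subOf : ∀ {a F H} → IsSub f H → a ∈ V H → F ⊆ E H → SubOf f (span a F) H
  span-subOf {a} {F} {H} H-sub a∈H F⊆H = span-isSub , V⊆ , F⊆H
    where
    V⊆ : V (span a F) ⊆ V H
    V⊆ v∈ with ∈span⁻ v∈
    ... | inj₁ refl = a∈H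
    ... | inj₂ (j , j∈F , v∈j) = H-sub j (F⊆H j∈F) _ v∈j

  -- F and the remaining edges of H span the two sides of a cut at a.
  separation⇒cut : ∀ {a H F k l} → IsSub f H → a ∈ V H
    → (∀ {v} → v ∈ V H → v ≢ a → IncidentIn (E H) v)
    → F ⊆ E H → (∀ {c d} → c ∈ F → d ∈ E H → Touch a c d → d ∈ F)
    → k ∈ F → l ∈ E H → l ∉ F → IsCutVertex f H a
  separation⇒cut {a} {H} {F} {k} {l} H-sub a∈H incident F⊆H F-closed k∈F l∈H l∉F =
    span a F , span a G , span-subOf H-sub a∈H F⊆H , span-subOf H-sub a∈H (p∩q⊆p _ _) ,
    (k , k∈F) , (l , ∈G⁺ l∈H l∉F) , V∪ , E∪ , V∩ , E∩
    where
    G : Subset m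
    G = E H ∩ ∁ F
    ∈G⁺ : ∀ {j} → j ∈ E H → j ∉ F → j ∈ G
    ∈G⁺ j∈H j∉F = x∈p∩q⁺ (j∈H , x∉p⇒x∈∁p j∉F)
    ∈G⁻ : ∀ {j} → j ∈ G → j ∈ E H × j ∉ F
    ∈G⁻ j∈G with x∈p∩q⁻ (E H) _ j∈G
    ... | j∈H , j∈∁F = j∈H , x∈∁p⇒x∉p j∈∁F

    sides : ∀ {j} → j ∈ E H → j ∈ F ⊎ j ∈ G
    sides {j} j∈H with j ∈? F
    ... | yes j∈F = inj₁ j∈F
    ... | no j∉F = inj₂ (∈G⁺ j∈H j∉F)

    V∪ : V (span a F) ∪ V (span a G) ≡ V H
    V∪ = ⊆-antisym ⊆H H⊆
      where
      ⊆H : V (span a F) ∪ V (span a G) ⊆ V H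
      ⊆H v∈ with x∈p∪q⁻ (V (span a F)) _ v∈
      ... | inj₁ v∈I = proj₁ (proj₂ (span-subOf H-sub a∈H F⊆H)) v∈I
      ... | inj₂ v∈J = proj₁ (proj₂ (span-subOf H-sub a∈H (p∩q⊆p _ _))) v∈J
      H⊆ : V H ⊆ V (span a F) ∪ V (span a G)
      H⊆ {v} v∈H with v ≟ a
      ... | yes v≡a = x∈p∪q⁺ (inj₁ (∈span⁺ (inj₁ v≡a)))
      ... | no v≢a with incident v∈H v≢a
      ...   | j , j∈H , v∈j with sides j∈H
      ...     | inj₁ j∈F = x∈p∪q⁺ (inj₁ (∈span⁺ (inj₂ (j , j∈F , v∈j))))
      ...     | inj₂ j∈G = x∈p∪q⁺ (inj₂ (∈span⁺ (inj₂ (j , j∈G , v∈j))))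

    E∪ : F ∪ G ≡ E H
    E∪ = ⊆-antisym ⊆H (x∈p∪q⁺ ∘ sides)
      where
      ⊆H : F ∪ G ⊆ E H
      ⊆H j∈ with x∈p∪q⁻ F G j∈
      ... | inj₁ j∈F = F⊆H j∈F
      ... | inj₂ j∈G = proj₁ (∈G⁻ j∈G)

    V∩ : V (span a F) ∩ V (span a G) ≡ ⁅ a ⁆
    V∩ = ⊆-antisym ⊆a (λ v∈a → x∈p∩q⁺ (lift (x∈⁅y⁆⇒x≡y a v∈a) , lift (x∈⁅y⁆⇒x≡y a v∈a)))
      where
      lift : ∀ {F′ v} → v ≡ a → v ∈ V (span a F′)
      lift v≡a = ∈span⁺ (inj₁ v≡a)
      ⊆a : V (span a F) ∩ V (span a G) ⊆ ⁅ a ⁆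
      ⊆a {v} v∈ with x∈p∩q⁻ (V (span a F)) _ v∈
      ... | v∈I , v∈J with ∈span⁻ v∈I | ∈span⁻ v∈J | v ≟ a
      ... | inj₁ refl | _ | _ = x∈⁅x⁆ a
      ... | _ | inj₁ refl | _ = x∈⁅x⁆ a
      ... | _ | _ | yes refl = x∈⁅x⁆ a
      ... | inj₂ (c , c∈F , v∈c) | inj₂ (d , d∈G , v∈d) | no v≢a =
        ⊥-elim (proj₂ (∈G⁻ d∈G) (F-closed c∈F (proj₁ (∈G⁻ d∈G)) (v , v≢a , v∈c , v∈d)))

    E∩ : F ∩ G ≡ ∅
    E∩ = ⊆-antisym (λ j∈ → ⊥-elim (proj₂ (∈G⁻ (proj₂ (x∈p∩q⁻ F G j∈))) (proj₁ (x∈p∩q⁻ F G j∈))))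
                   (⊥-elim ∘ ∉⊥)

module _ {n m} {e : Edges n m} {α : Fin n} where

  wing-incident : ∀ {W v} → IsWing e α W → v ∈ V W → v ≢ α → IncidentIn e (E W) v
  wing-incident (_ , α∈W , _ , connected , _) v∈W v≢α with reach⇒≡⊎incident e (connected α _ α∈W v∈W)
  ... | inj₁ α≡v = ⊥-elim (v≢α (sym α≡v))
  ... | inj₂ incident = incident

  wing-α-incident : ∀ {W} → NonemptyEdges e → IsWing e α W → IncidentIn e (E W) α
  wing-α-incident nonempty (W-sub , α∈W , (j , j∈W) , connected , _) with nonempty j
  ... | v , v∈j with v ≟ α
  ...   | yes refl = j , j∈W , v∈j
  ...   | no v≢α with reach⇒≡⊎incident e (reach-sym e W-sub (connected α v α∈W (W-sub j j∈W v v∈j)))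
  ...     | inj₁ v≡α = ⊥-elim (v≢α v≡α)
  ...     | inj₂ incident = incident

  wing-touch-closed : ∀ {W c d} → IsWing e α W → c ∈ E W → Touch e α c d → d ∈ E W
  wing-touch-closed {W} {c} {d} (W-sub , _ , _ , _ , _ , outside) c∈W (v , v≢α , v∈c , v∈d) with d ∈? E W
  ... | yes d∈W = d∈W
  ... | no d∉W = ⊥-elim (>⇒≢ v∈d (outside d d∉W v (W-sub c c∈W v v∈c) v≢α))

  wing-chained : ∀ {W k} → IsWing e α W → k ∈ E W → ChainedFrom e α W k
  wing-chained {W} {k} w@(W-sub , α∈W , _ , _ , not-cut , _) k∈W {l} l∈W = chain-to (l ∈? members)
    where
    open Closure (closure (touch? e α) k)
    C⊆W : members ⊆ E W
    C⊆W c∈C = star-preserves (_∈ E W) (wing-touch-closed w) k∈W (reachable c∈C)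
    chain-to : Dec (l ∈ members) → Chain e α (E W) k l
    chain-to (yes l∈C) = star-within (E W) (wing-touch-closed w) k∈W (reachable l∈C)
    chain-to (no l∉C) = ⊥-elim (not-cut
      (separation⇒cut e W-sub α∈W (wing-incident w) C⊆W (λ c∈C _ → closed c∈C) source∈ l∈W l∉C))

  α-edge⇒wing : ∀ {j} → 0 < e j α → ∃ λ W → IsWing e α W × j ∈ E W
  α-edge⇒wing {j} α∈j =
    span e α members , (span-isSub e , ∈span⁺ e (inj₁ refl) , (j , source∈) , connected , not-cut , outside) , source∈
    where
    open Closure (closure (touch? e α) j)
    chained : ChainedFrom e α (span e α members) j
    chained c∈C = star-within members (λ c∈C → closed c∈C) source∈ (reachable c∈C)
    incident : ∀ {v} → v ∈ V (span e α members) → IncidentIn e members v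
    incident v∈ with ∈span⁻ e v∈
    ... | inj₁ refl = j , source∈ , α∈j
    ... | inj₂ v-incident = v-incident
    connected : Connected e (span e α members)
    connected = rooted⇒connected e (span-isSub e) source∈ α∈j chained incident
    not-cut : ¬ IsCutVertex e (span e α members) α
    not-cut = rooted⇒¬cut e source∈ chained
    outside : ∀ k → k ∉ members → ∀ v → v ∈ V (span e α members) → v ≢ α → e k v ≡ 0
    outside k k∉C v v∈ v≢α with ∈span⁻ e v∈
    ... | inj₁ v≡α = ⊥-elim (v≢α v≡α)
    ... | inj₂ (c , c∈C , v∈c) with e k v ≟ℕ 0
    ...   | yes k∌v = k∌v
    ...   | no k∋v = ⊥-elim (k∉C (closed c∈C (v , v≢α , v∈c , n≢0⇒n>0 k∋v)))

Contributes : ∀ {n m} → Edges n m → Fin n → (Fin m → ℕ) → Sub n m → Set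
Contributes e α i W = Detached e α i W ⊎ SemiDetached e α i W

module Detachment {n m} (e : Edges n m) (α : Fin n) (i : Fin m → ℕ) where

  detach-≢ : ∀ {j v} → v ≢ α → detach e α i j (suc v) ≡ e j v
  detach-≢ {v = v} v≢α with v ≟ α
  ... | yes v≡α = ⊥-elim (v≢α v≡α)
  ... | no _ = refl

  detach-α : ∀ {j} → detach e α i j (suc α) ≡ e j α ∸ i j
  detach-α with α ≟ α
  ... | yes _ = refl
  ... | no α≢α = ⊥-elim (α≢α refl)

  deg-detach : (∀ j → i j ≤ e j α) → ∀ F
    → deg e F α ≡ deg (detach e α i) F (suc α) + deg (detach e α i) F zero
  deg-detach i≤ F =
    trans (cong sum (tabulate-cong split)) (sum-tabulate-+ (term (suc α)) (term zero))
    where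
    term : Fin (suc n) → Fin m → ℕ
    term v j = if lookup F j then detach e α i j v else 0
    split : ∀ j → (if lookup F j then e j α else 0) ≡ term (suc α) j + term zero j
    split j with lookup F j
    ... | true = trans (sym (m∸n+n≡m (i≤ j))) (cong (_+ i j) (sym detach-α))
    ... | false = refl

  chain-detach : ∀ {S S′ k l} → S ⊆ S′ → Chain e α S k l → Chain (detach e α i) (suc α) S′ k l
  chain-detach S⊆S′ = map λ where
    (d∈S , v , v≢α , v∈c , v∈d) →
      S⊆S′ d∈S , suc v , v≢α ∘ Fin-suc-injective ,
      subst (0 <_) (sym (detach-≢ v≢α)) v∈c , subst (0 <_) (sym (detach-≢ v≢α)) v∈d

  contributes⇒β-incident : ∀ {W} → NonemptyEdges e → (∀ j → i j ≤ e j α) → IsWing e α W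
    → Contributes e α i W → IncidentIn (detach e α i) (E W) zero
  contributes⇒β-incident {W} nonempty i≤ w c = deg-pos⇒incident (detach e α i) zero (β-pos c)
    where
    split : deg e (E W) α ≡ deg (detach e α i) (E W) (suc α) + deg (detach e α i) (E W) zero
    split = deg-detach i≤ (E W)
    β-pos : Contributes e α i W → 0 < deg (detach e α i) (E W) zero
    β-pos (inj₁ detached) with wing-α-incident nonempty w
    ... | j , j∈W , α∈j =
      subst (0 <_) (trans split (cong (_+ deg (detach e α i) (E W) zero) detached))
        (<-≤-trans α∈j (deg-≥ e α j∈W))
    β-pos (inj₂ (_ , lt)) =
      +-cancelˡ-< (deg (detach e α i) (E W) (suc α)) 0 _ (subst₂ _<_ (sym (+-identityʳ _)) split lt)

  β-incident⇒contributes : ∀ {W j} → (∀ j → i j ≤ e j α) → j ∈ E W → 0 < i j → Contributes e α i W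
  β-incident⇒contributes {W} {j} i≤ j∈W β∈j with deg (detach e α i) (E W) (suc α) ≟ℕ 0
  ... | yes detached = inj₁ detached
  ... | no not-detached = inj₂ (n≢0⇒n>0 not-detached , lt)
    where
    lt : deg (detach e α i) (E W) (suc α) < deg e (E W) α
    lt = subst (deg (detach e α i) (E W) (suc α) <_) (sym (deg-detach i≤ (E W)))
           (m<m+n _ (<-≤-trans β∈j (deg-≥ (detach e α i) zero j∈W)))

  β∈prime : ∀ {W j} → j ∈ E W → 0 < i j → zero ∈ V (prime e α i W)
  β∈prime {W} {j} j∈W β∈j = zero∈ (<⇒<ᵇ (<-≤-trans β∈j (deg-≥ (detach e α i) zero j∈W)))
    where
    zero∈ : ∀ {b} → T b → zero ∈ b ∷ V W
    zero∈ {true} _ = here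

module WingUnion {n m} (e : Edges n m) (nonempty : NonemptyEdges e) (α : Fin n)
  (i : Fin m → ℕ) (i≤ : ∀ j → i j ≤ e j α)
  (W₀ : Sub n m) (W₀-wing : IsWing e α W₀) (W₀-semi : SemiDetached e α i W₀)
  (Z : Sub (suc n) m)
  (V-Z : ∀ v → (v ∈ V Z) ⇔ (∃ λ W → IsWing e α W × Contributes e α i W × v ∈ V (prime e α i W)))
  (E-Z : ∀ j → (j ∈ E Z) ⇔ (∃ λ W → IsWing e α W × Contributes e α i W × j ∈ E (prime e α i W)))
  where

  open Detachment e α i

  e′ : Edges (suc n) m
  e′ = detach e α i

  to-V : ∀ {v} → (∃ λ W → IsWing e α W × Contributes e α i W × v ∈ V (prime e α i W)) → v ∈ V Z
  to-V {v} = Equivalence.from (V-Z v)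

  from-V : ∀ {v} → v ∈ V Z → ∃ λ W → IsWing e α W × Contributes e α i W × v ∈ V (prime e α i W)
  from-V {v} = Equivalence.to (V-Z v)

  from-E : ∀ {j} → j ∈ E Z → ∃ λ W → IsWing e α W × Contributes e α i W × j ∈ E W
  from-E {j} = Equivalence.to (E-Z j)

  wing⊆Z : ∀ {W} → IsWing e α W → Contributes e α i W → E W ⊆ E Z
  wing⊆Z {W} w c {j} j∈W = Equivalence.from (E-Z j) (W , w , c , j∈W)

  Z-isSub : IsSub e′ Z
  Z-isSub j j∈Z v v∈j with from-E j∈Z
  ... | W , w@(W-sub , α∈W , _) , c , j∈W = to-V (W , w , c , ∈W′ v v∈j)
    where
    ∈W′ : ∀ v → 0 < e′ j v → v ∈ V (prime e α i W)
    ∈W′ zero β∈j = β∈prime j∈W β∈j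
    ∈W′ (suc y) y∈j with y ≟ α
    ... | yes refl = there α∈W
    ... | no _ = there (W-sub j j∈W y y∈j)

  α′∈Z : suc α ∈ V Z
  α′∈Z = to-V (W₀ , W₀-wing , inj₂ W₀-semi , there (proj₁ (proj₂ W₀-wing)))

  root : IncidentIn e′ (E Z) zero
  root with contributes⇒β-incident nonempty i≤ W₀-wing (inj₂ W₀-semi)
  ... | r , r∈W₀ , β∈r = r , wing⊆Z W₀-wing (inj₂ W₀-semi) r∈W₀ , β∈r

  r : Fin m
  r = proj₁ root

  r∈Z : r ∈ E Z
  r∈Z = proj₁ (proj₂ root)

  β∈r : 0 < e′ r zero
  β∈r = proj₂ (proj₂ root)

  -- r and the β-edge of any contributing wing touch at β, which is not α′
  Z-chained : ChainedFrom e′ (suc α) Z r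
  Z-chained k∈Z with from-E k∈Z
  ... | W , w , c , k∈W with contributes⇒β-incident nonempty i≤ w c
  ...   | b , b∈W , β∈b =
    (wing⊆Z w c b∈W , zero , (λ ()) , β∈r , β∈b) ◅ chain-detach (wing⊆Z w c) (wing-chained w b∈W k∈W)

  α′-incident : IncidentIn e′ (E Z) (suc α)
  α′-incident with deg-pos⇒incident e′ (suc α) (proj₁ W₀-semi)
  ... | k , k∈W₀ , α′∈k = k , wing⊆Z W₀-wing (inj₂ W₀-semi) k∈W₀ , α′∈k

  Z-incident : ∀ {v} → v ∈ V Z → IncidentIn e′ (E Z) v
  Z-incident {zero} _ = root
  Z-incident {suc y} y∈Z = incident (y ≟ α)
    where
    incident : Dec (y ≡ α) → IncidentIn e′ (E Z) (suc y)
    incident (yes y≡α) = subst (IncidentIn e′ (E Z) ∘ suc) (sym y≡α) α′-incident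
    incident (no y≢α) with from-V y∈Z
    ... | W , w , c , y∈W′ with wing-incident w (drop-there y∈W′) y≢α
    ...   | k , k∈W , y∈k = k , wing⊆Z w c k∈W , subst (0 <_) (sym (detach-≢ y≢α)) y∈k

  Z-outside : ∀ j → j ∉ E Z → ∀ v → v ∈ V Z → v ≢ suc α → e′ j v ≡ 0
  Z-outside j j∉Z zero _ _ with i j ≟ℕ 0
  ... | yes β∉j = β∉j
  ... | no β∈j with α-edge⇒wing (<-≤-trans (n≢0⇒n>0 β∈j) (i≤ j))
  ...   | W , w , j∈W = ⊥-elim (j∉Z (wing⊆Z w (β-incident⇒contributes {W = W} i≤ j∈W (n≢0⇒n>0 β∈j)) j∈W))
  Z-outside j j∉Z (suc y) y∈Z y′≢α′ with from-V y∈Z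
  ... | W , w@(_ , _ , _ , _ , _ , W-outside) , c , y∈W′ =
    trans (detach-≢ y≢α) (W-outside j (j∉Z ∘ wing⊆Z w c) y (drop-there y∈W′) y≢α)
    where
    y≢α : y ≢ α
    y≢α = y′≢α′ ∘ cong suc

lemma3p2 : ∀ {n m} (e : Edges n m) → NonemptyEdges e → (α : Fin n)
    → (i : Fin m → ℕ) → (∀ j → i j ≤ e j α)
    → (∃ λ W → IsWing e α W × SemiDetached e α i W)
    → (Z : Sub (suc n) m)
    → (∀ v → (v ∈ V Z) ⇔ (∃ λ W → IsWing e α W × (Detached e α i W ⊎ SemiDetached e α i W) × v ∈ V (prime e α i W)))
    → (∀ j → (j ∈ E Z) ⇔ (∃ λ W → IsWing e α W × (Detached e α i W ⊎ SemiDetached e α i W) × j ∈ E (prime e α i W)))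
    → IsWing (detach e α i) (suc α) Z
lemma3p2 e nonempty α i i≤ (W₀ , W₀-wing , W₀-semi) Z V-Z E-Z =
  Z-isSub , α′∈Z , (r , r∈Z) ,
  rooted⇒connected e′ {ρ = zero} Z-isSub r∈Z β∈r Z-chained Z-incident ,
  rooted⇒¬cut e′ r∈Z Z-chained ,
  Z-outside
  where
  open WingUnion e nonempty α i i≤ W₀ W₀-wing W₀-semi Z V-Z E-Z
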